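{- For every digraph $G$, $\mathrm{d\text{ - }lnlcw}(G)\le\mathrm{d\text{ - }lcw}(G)\le\mathrm{d\text{ - }lnlcw}(G)+1$.
   Context: Digraphs are finite with no loops. $\mathrm{d\text{ - }lnlcw}(G)$ is the least $k$ such that $G$ (under some labeling, labels then forgotten) is built from labeled digraphs with labels in $[k]=\{1,\dots,k\}$ by: $\bullet_a$ (a single vertex labeled $a$); $H\otimes_{(\overrightarrow S,\overleftarrow S)}\bullet_a$ ($\overrightarrow S,\overleftarrow S\subseteq[k]^2$): add a new vertex $v$ labeled $a$ plus arcs $(u,v)$ for every $u$ in $H$ of label $b$ with $(b,a)\in\overrightarrow S$ and arcs $(v,u)$ for every $u$ in $H$ of label $b$ with $(b,a)\in\overleftarrow S$; $\circ_R$ ($R:[k]\to[k]$, change every label $a$ to $R(a)$). $\mathrm{d\text{ - }lcw}(G)$ is the least number of labels to build $G$ with $\bullet_a$, $H\oplus\bullet_a$ (disjoint union with a new vertex labeled $a$), $\alpha_{a,b}$ ($a\ne b$; add an arc from every label-$a$ vertex to every label-$b$ vertex), $\rho_{a\to b}$ (change label $a$ into $b$). -}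

module Defs where

open import Data.Nat using (ℕ; zero; suc; _≤_; _+_)
open import Data.Fin using (Fin; zero; suc; _≟_)
open import Data.Bool using (Bool; true; false; _∧_; _∨_; if_then_else_)
open import Data.Product using (Σ; _×_)
open import Relation.Nullary using (¬_)
open import Relation.Nullary.Decidable using (⌊_⌋)
open import Relation.Binary.PropositionalEquality using (_≡_)
open import Function.Bundles using (_⤖_; Bijection)

record Digraph : Set where
  field
    n        : ℕ
    arc      : Fin n → Fin n → Bool
    loopless : ∀ i → arc i i ≡ false

record LDigraph (k n : ℕ) : Set where
  field
    lab : Fin n → Fin k
    arc : Fin n → Fin n → Bool

_==_ : ∀ {k} → Fin k → Fin k → Bool
a == b = ⌊ a ≟ b ⌋

data LNL (k : ℕ) : ℕ → Set where
  vtx   : Fin k → LNL k 1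
  ext   : ∀ {n} → LNL k n → (S→ S← : Fin k → Fin k → Bool) → Fin k → LNL k (suc n)
  relab : ∀ {n} → (Fin k → Fin k) → LNL k n → LNL k n

-- In the extension step the new vertex is `zero`, old vertex i becomes `suc i`.
⟦_⟧ₗ : ∀ {k n} → LNL k n → LDigraph k n
⟦ vtx a ⟧ₗ = record { lab = λ _ → a ; arc = λ _ _ → false }
⟦ ext {n} t S→ S← a ⟧ₗ = record { lab = L ; arc = A }
  where
  H = ⟦ t ⟧ₗ
  L : Fin (suc n) → Fin _
  L zero = a
  L (suc i) = LDigraph.lab H i
  A : Fin (suc n) → Fin (suc n) → Bool
  A zero zero = false
  A (suc u) zero = S→ (LDigraph.lab H u) a
  A zero (suc u) = S← (LDigraph.lab H u) a
  A (suc u) (suc v) = LDigraph.arc H u v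
⟦ relab R t ⟧ₗ = record { lab = λ u → R (LDigraph.lab ⟦ t ⟧ₗ u) ; arc = LDigraph.arc ⟦ t ⟧ₗ }

data LCW (k : ℕ) : ℕ → Set where
  vtx : Fin k → LCW k 1
  add : ∀ {n} → LCW k n → Fin k → LCW k (suc n)
  α   : ∀ {n} → (a b : Fin k) → ¬ (a ≡ b) → LCW k n → LCW k n
  ρ   : ∀ {n} → (a b : Fin k) → LCW k n → LCW k n

⟦_⟧ᶜ : ∀ {k n} → LCW k n → LDigraph k n
⟦ vtx a ⟧ᶜ = record { lab = λ _ → a ; arc = λ _ _ → false }
⟦ add {n} t a ⟧ᶜ = record { lab = L ; arc = A }
  where
  H = ⟦ t ⟧ᶜ
  L : Fin (suc n) → Fin _
  L zero = a
  L (suc i) = LDigraph.lab H i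
  A : Fin (suc n) → Fin (suc n) → Bool
  A (suc u) (suc v) = LDigraph.arc H u v
  A _ _ = false
⟦ α a b _ t ⟧ᶜ = record
  { lab = LDigraph.lab ⟦ t ⟧ᶜ
  ; arc = λ u v → LDigraph.arc ⟦ t ⟧ᶜ u v
                  ∨ ((LDigraph.lab ⟦ t ⟧ᶜ u == a) ∧ (LDigraph.lab ⟦ t ⟧ᶜ v == b)) }
⟦ ρ a b t ⟧ᶜ = record
  { lab = λ u → if LDigraph.lab ⟦ t ⟧ᶜ u == a then b else LDigraph.lab ⟦ t ⟧ᶜ u
  ; arc = LDigraph.arc ⟦ t ⟧ᶜ }

Represents : ∀ {k} (G : Digraph) → LDigraph k (Digraph.n G) → Set
Represents G H = Σ (Fin (Digraph.n G) ⤖ Fin (Digraph.n G)) λ f →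
  ∀ u v → LDigraph.arc H u v ≡ Digraph.arc G (Bijection.to f u) (Bijection.to f v)

LnlBuildable : ℕ → Digraph → Set
LnlBuildable k G = Σ (LNL k (Digraph.n G)) λ t → Represents G ⟦ t ⟧ₗ

LcwBuildable : ℕ → Digraph → Set
LcwBuildable k G = Σ (LCW k (Digraph.n G)) λ t → Represents G ⟦ t ⟧ᶜ

IsDLnlcw : Digraph → ℕ → Set
IsDLnlcw G k = LnlBuildable k G × (∀ j → LnlBuildable j G → k ≤ j)

IsDLcw : Digraph → ℕ → Set
IsDLcw G k = LcwBuildable k G × (∀ j → LcwBuildable j G → k ≤ j)

module Submission where

-- Both inequalities are proved by translating expressions.
--
-- (1) LCW k → LNL k.  Read an LCW expression from the root downwards and carry
--     the relation F on labels of "arcs still to be added later" by the α's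
--     above the current subterm (ρ's above are accounted for by reading F
--     through the renaming).  When a vertex is added, all its arcs to earlier
--     vertices are already determined by F, so ⊕ becomes one extension step.
--
-- (2) LNL k → LCW (k+1).  Label 0 is kept spare; label suc c of the LCW
--     expression denotes label π c of the LNL expression, so a relabeling
--     R only changes π.  An extension by a vertex of label a adds the vertex
--     with the spare label, adds its arcs by α's to/from the spare label
--     (any irreflexive label relation can be realized by α's), and renames
--     0 to some suc c with π c ≡ a.  Such c exists after at most one merge:
--     if π misses a it is not injective, and two labels with equal image
--     may be merged by a ρ, freeing one of them for a.

open import Data.Bool using (Bool; true; false; _∧_; _∨_; if_then_else_)
open import Data.Bool.Properties using (∨-assoc; ∨-identityʳ; ∧-zeroʳ; ∧-identityʳ)
open import Data.Fin using (Fin; zero; suc; _≟_; punchOut)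
open import Data.Fin.Properties using (any?; pigeonhole; <⇒≢; punchOut-injective; suc-injective)
open import Data.Nat using (ℕ; zero; suc; _≤_; _+_; s≤s)
open import Data.Nat.Properties using (≤-refl; +-comm)
open import Data.Product using (Σ; ∃₂; _×_; _,_)
open import Data.Vec.Functional using (Vector; foldr; foldl; updateAt)
open import Data.Vec.Functional.Properties using (updateAt-updates; updateAt-minimal)
open import Function using (_∘_; flip; const)
open import Relation.Binary.PropositionalEquality
open import Relation.Nullary using (¬_; yes; no)
open import Relation.Nullary.Decidable using (dec-true; dec-false; isYes≗does)
open import Defs

open ≡-Reasoning

labL : ∀ {k n} → LNL k n → Fin n → Fin k
labL t = LDigraph.lab ⟦ t ⟧ₗ

arcL : ∀ {k n} → LNL k n → Fin n → Fin n → Bool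
arcL t = LDigraph.arc ⟦ t ⟧ₗ

labC : ∀ {k n} → LCW k n → Fin n → Fin k
labC e = LDigraph.lab ⟦ e ⟧ᶜ

arcC : ∀ {k n} → LCW k n → Fin n → Fin n → Bool
arcC e = LDigraph.arc ⟦ e ⟧ᶜ

==-refl : ∀ {k} (a : Fin k) → (a == a) ≡ true
==-refl a = trans (isYes≗does (a ≟ a)) (dec-true (a ≟ a) refl)

==-no : ∀ {k} {a b : Fin k} → ¬ a ≡ b → (a == b) ≡ false
==-no {a = a} {b} a≢b = trans (isYes≗does (a ≟ b)) (dec-false (a ≟ b) a≢b)

LabelRel : ℕ → Set
LabelRel k = Fin k → Fin k → Bool

-- Relations realized by arcs must be irreflexive, as digraphs have no loops.
Irreflexive : ∀ {k} → LabelRel k → Set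
Irreflexive E = ∀ a → E a a ≡ false

rename : ∀ {k} → Fin k → Fin k → Fin k → Fin k
rename a b x = if x == a then b else x

rename-hit : ∀ {k} (a b : Fin k) → rename a b a ≡ b
rename-hit a b = cong (if_then b else a) (==-refl a)

rename-miss : ∀ {k} {a x : Fin k} b → ¬ x ≡ a → rename a b x ≡ x
rename-miss {x = x} b x≢a = cong (if_then b else x) (==-no x≢a)

-- (1) From LCW expressions to LNL expressions with the same labels.

-- The pending relation below α a b: the pair (a , b) is joined on top of F.
withPair : ∀ {k} → Fin k → Fin k → LabelRel k → LabelRel k
withPair a b F c d = ((c == a) ∧ (d == b)) ∨ F c d

-- The pending relation below ρ a b: F read through the renaming.
renamed : ∀ {k} → Fin k → Fin k → LabelRel k → LabelRel k
renamed a b F c d = F (rename a b c) (rename a b d)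

withPair-irreflexive : ∀ {k} (a b : Fin k) F → ¬ a ≡ b → Irreflexive F →
  Irreflexive (withPair a b F)
withPair-irreflexive a b F a≢b irr c with c ≟ a
... | no _     = irr c
... | yes refl = trans (cong (_∨ F c c) (==-no a≢b)) (irr c)

renamed-irreflexive : ∀ {k} (a b : Fin k) F → Irreflexive F → Irreflexive (renamed a b F)
renamed-irreflexive a b F irr c = irr (rename a b c)

-- The translation, given the relation F of arcs still to be added above.
toLnl : ∀ {k n} → LCW k n → LabelRel k → LNL k n
toLnl (vtx a)       F = vtx a
toLnl (add e a)     F = ext (toLnl e F) F (flip F) a
toLnl (α a b _ e)   F = toLnl e (withPair a b F)
toLnl (ρ a b e)     F = relab (rename a b) (toLnl e (renamed a b F))

toLnl-lab : ∀ {k n} (e : LCW k n) F u → labL (toLnl e F) u ≡ labC e u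
toLnl-lab (vtx a)     F u       = refl
toLnl-lab (add e a)   F zero    = refl
toLnl-lab (add e a)   F (suc u) = toLnl-lab e F u
toLnl-lab (α a b _ e) F u       = toLnl-lab e _ u
toLnl-lab (ρ a b e)   F u       = cong (rename a b) (toLnl-lab e _ u)

toLnl-arc : ∀ {k n} (e : LCW k n) F → Irreflexive F → ∀ u v →
  arcL (toLnl e F) u v ≡ (arcC e u v ∨ F (labC e u) (labC e v))
toLnl-arc (vtx a)   F irr u v = sym (irr a)
toLnl-arc (add e a) F irr zero    zero    = sym (irr a)
toLnl-arc (add e a) F irr zero    (suc v) = cong (F a) (toLnl-lab e F v)
toLnl-arc (add e a) F irr (suc u) zero    = cong (flip F a) (toLnl-lab e F u)
toLnl-arc (add e a) F irr (suc u) (suc v) = toLnl-arc e F irr u v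
toLnl-arc (α a b a≢b e) F irr u v =
  trans (toLnl-arc e _ (withPair-irreflexive a b F a≢b irr) u v) (sym (∨-assoc (arcC e u v) _ _))
toLnl-arc (ρ a b e) F irr u v = toLnl-arc e _ (renamed-irreflexive a b F irr) u v

-- At the root nothing is pending.
lcw⇒lnl : ∀ {k} G → LcwBuildable k G → LnlBuildable k G
lcw⇒lnl G (e , f , represents) = toLnl e (λ _ _ → false) , f , λ u v →
  trans (toLnl-arc e _ (λ _ → refl) u v) (trans (∨-identityʳ _) (represents u v))

-- (2a) Any irreflexive label relation can be realized by α's.

anyOf : ∀ {m} → Vector Bool m → Bool
anyOf = foldr _∨_ false

anyOf-false : ∀ {m} (f : Vector Bool m) → (∀ i → f i ≡ false) → anyOf f ≡ false
anyOf-false {zero}  f all-false = refl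
anyOf-false {suc m} f all-false =
  cong₂ _∨_ (all-false zero) (anyOf-false (f ∘ suc) (all-false ∘ suc))

anyOf-single : ∀ {m} (f : Vector Bool m) c → (∀ i → ¬ i ≡ c → f i ≡ false) → anyOf f ≡ f c
anyOf-single f zero off-c =
  trans (cong (f zero ∨_) (anyOf-false (f ∘ suc) (λ i → off-c (suc i) (λ ()))))
        (∨-identityʳ (f zero))
anyOf-single f (suc c) off-c =
  trans (cong (_∨ anyOf (f ∘ suc)) (off-c zero (λ ())))
        (anyOf-single (f ∘ suc) c (λ i i≢c → off-c (suc i) (i≢c ∘ suc-injective)))

runAll : ∀ {A : Set} {m} → Vector (A → A) m → A → A
runAll ss x = foldl (λ y s → s y) x ss

record AddsArcs {K n} (E : LabelRel K) (s : LCW K n → LCW K n) : Set where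
  field
    keeps-lab : ∀ e u → labC (s e) u ≡ labC e u
    adds-arc  : ∀ e u v → arcC (s e) u v ≡ (arcC e u v ∨ E (labC e u) (labC e v))

open AddsArcs

AddsArcs-cong : ∀ {K n} {E E′ : LabelRel K} {s : LCW K n → LCW K n} →
  (∀ x y → E x y ≡ E′ x y) → AddsArcs E s → AddsArcs E′ s
AddsArcs-cong E≗E′ adds .keeps-lab = keeps-lab adds
AddsArcs-cong E≗E′ adds .adds-arc e u v =
  trans (adds-arc adds e u v) (cong (arcC e u v ∨_) (E≗E′ (labC e u) (labC e v)))

runAll-adds : ∀ {K n m} {E : Fin m → LabelRel K} {ss : Vector (LCW K n → LCW K n) m} →
  (∀ i → AddsArcs (E i) (ss i)) → AddsArcs (λ x y → anyOf (λ i → E i x y)) (runAll ss)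
runAll-adds {m = zero} adds .keeps-lab e u = refl
runAll-adds {m = zero} adds .adds-arc e u v = sym (∨-identityʳ _)
runAll-adds {m = suc m} adds .keeps-lab e u =
  trans (keeps-lab (runAll-adds (adds ∘ suc)) _ u) (keeps-lab (adds zero) e u)
runAll-adds {K} {n} {suc m} {E} {ss} adds .adds-arc e u v =
  begin
    arcC (runAll (ss ∘ suc) e₁) u v
  ≡⟨ adds-arc (runAll-adds (adds ∘ suc)) e₁ u v ⟩
    arcC e₁ u v ∨ anyOf (λ i → E (suc i) (labC e₁ u) (labC e₁ v))
  ≡⟨ cong₂ (λ x y → arcC e₁ u v ∨ anyOf (λ i → E (suc i) x y))
           (keeps-lab (adds zero) e u) (keeps-lab (adds zero) e v) ⟩
    arcC e₁ u v ∨ anyOf (λ i → E (suc i) x y)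
  ≡⟨ cong (_∨ anyOf (λ i → E (suc i) x y)) (adds-arc (adds zero) e u v) ⟩
    (arcC e u v ∨ E zero x y) ∨ anyOf (λ i → E (suc i) x y)
  ≡⟨ ∨-assoc (arcC e u v) _ _ ⟩
    arcC e u v ∨ anyOf (λ i → E i x y)
  ∎
  where
  e₁ : LCW K n
  e₁ = ss zero e
  x y : Fin K
  x = labC e u
  y = labC e v

αWhen : ∀ {K n} → LabelRel K → Fin K → Fin K → LCW K n → LCW K n
αWhen E a b e with a ≟ b | E a b
... | no a≢b | true = α a b a≢b e
... | _      | _    = e

αWhen-adds : ∀ {K n} {E : LabelRel K} → Irreflexive E → ∀ a b →
  AddsArcs {n = n} (λ x y → ((x == a) ∧ (y == b)) ∧ E a b) (αWhen E a b)
αWhen-adds {E = E} irr a b .keeps-lab e u with a ≟ b | E a b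
... | no _  | true  = refl
... | no _  | false = refl
... | yes _ | _     = refl
αWhen-adds {E = E} irr a b .adds-arc e u v with a ≟ b | E a b in Eab
... | no _     | true  = cong (arcC e u v ∨_) (sym (∧-identityʳ _))
... | no _     | false = sym (trans (cong (arcC e u v ∨_) (∧-zeroʳ _)) (∨-identityʳ _))
... | yes _    | false = sym (trans (cong (arcC e u v ∨_) (∧-zeroʳ _)) (∨-identityʳ _))
... | yes refl | true  with () ← trans (sym Eab) (irr a)

anyPair-select : ∀ {K} (E : LabelRel K) x y →
  anyOf (λ a → anyOf (λ b → ((x == a) ∧ (y == b)) ∧ E a b)) ≡ E x y
anyPair-select E x y =
  begin
    anyOf (λ a → anyOf (λ b → ((x == a) ∧ (y == b)) ∧ E a b))
  ≡⟨ anyOf-single _ x off-row ⟩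
    anyOf (λ b → ((x == x) ∧ (y == b)) ∧ E x b)
  ≡⟨ anyOf-single _ y off-column ⟩
    ((x == x) ∧ (y == y)) ∧ E x y
  ≡⟨ cong₂ (λ p q → (p ∧ q) ∧ E x y) (==-refl x) (==-refl y) ⟩
    E x y
  ∎
  where
  off-row : ∀ a → ¬ a ≡ x → anyOf (λ b → ((x == a) ∧ (y == b)) ∧ E a b) ≡ false
  off-row a a≢x = anyOf-false _ λ b → cong (λ p → (p ∧ (y == b)) ∧ E a b) (==-no (a≢x ∘ sym))
  off-column : ∀ b → ¬ b ≡ y → ((x == x) ∧ (y == b)) ∧ E x b ≡ false
  off-column b b≢y = cong₂ (λ p q → (p ∧ q) ∧ E x b) (==-refl x) (==-no (b≢y ∘ sym))

αAll : ∀ {K n} → LabelRel K → LCW K n → LCW K n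
αAll E = runAll (λ a → runAll (λ b → αWhen E a b))

αAll-adds : ∀ {K n} {E : LabelRel K} → Irreflexive E → AddsArcs {n = n} E (αAll E)
αAll-adds {E = E} irr =
  AddsArcs-cong (anyPair-select E)
    (runAll-adds (λ a → runAll-adds (λ b → αWhen-adds irr a b)))

-- (2b) From LNL expressions with k labels to LCW expressions with k+1 labels.

record Simulates {k n} (e : LCW (suc k) n) (t : LNL k n) (π : Fin k → Fin k) : Set where
  field
    label : ∀ u → Σ (Fin k) λ c → labC e u ≡ suc c × π c ≡ labL t u
    arcs  : ∀ u v → arcC e u v ≡ arcL t u v

open Simulates

missing⇒collision : ∀ {k} (π : Fin k → Fin k) (a : Fin k) → (∀ c → ¬ π c ≡ a) →
  ∃₂ λ c₁ c₂ → ¬ c₁ ≡ c₂ × π c₁ ≡ π c₂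
missing⇒collision {suc k} π a missing with pigeonhole (s≤s ≤-refl) squeezed
  where
  squeezed : Fin (suc k) → Fin k
  squeezed c = punchOut (missing c ∘ sym)
... | c₁ , c₂ , c₁<c₂ , same =
  c₁ , c₂ , <⇒≢ c₁<c₂ , punchOut-injective (missing c₁ ∘ sym) (missing c₂ ∘ sym) same

-- If π c₁ ≡ π c₂, merging label suc c₁ into suc c₂ frees c₁, which may then stand for any a.
merge : ∀ {k n} {e : LCW (suc k) n} {t π} → Simulates e t π →
  ∀ {c₁ c₂} → ¬ c₁ ≡ c₂ → π c₁ ≡ π c₂ → (a : Fin k) →
  Simulates (ρ (suc c₁) (suc c₂) e) t (updateAt π c₁ (const a))
merge sim c₁≢c₂ same a .arcs = arcs sim
merge {π = π} sim {c₁} {c₂} c₁≢c₂ same a .label u with label sim u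
... | c , lab≡ , πc with c ≟ c₁
...   | yes refl = c₂ ,
        trans (cong (rename (suc c) (suc c₂)) lab≡) (rename-hit (suc c) (suc c₂)) ,
        trans (updateAt-minimal c₂ c π (c₁≢c₂ ∘ sym)) (trans (sym same) πc)
...   | no c≢c₁ = c ,
        trans (cong (rename (suc c₁) (suc c₂)) lab≡) (rename-miss (suc c₂) (c≢c₁ ∘ suc-injective)) ,
        trans (updateAt-minimal c c₁ π c≢c₁) πc

freshen : ∀ {k n} {e : LCW (suc k) n} {t π} → Simulates e t π → (a : Fin k) →
  Σ (LCW (suc k) n) λ e′ → Σ (Fin k → Fin k) λ π′ → Σ (Fin k) λ c →
    π′ c ≡ a × Simulates e′ t π′
freshen {e = e} {π = π} sim a with any? (λ c → π c ≟ a)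
... | yes (c , πc≡a) = e , π , c , πc≡a , sim
... | no no-preimage with missing⇒collision π a (λ c πc≡a → no-preimage (c , πc≡a))
...   | c₁ , c₂ , c₁≢c₂ , same =
  ρ (suc c₁) (suc c₂) e , updateAt π c₁ (const a) , c₁ ,
  updateAt-updates c₁ π , merge sim c₁≢c₂ same a

-- The arcs of the new vertex (label zero) in an extension step, read on simulation labels.
newArcs : ∀ {k} (S→ S← : LabelRel k) (a : Fin k) (π : Fin k → Fin k) → LabelRel (suc k)
newArcs S→ S← a π zero    (suc b) = S← (π b) a
newArcs S→ S← a π (suc b) zero    = S→ (π b) a
newArcs S→ S← a π _       _       = false

newArcs-irreflexive : ∀ {k} S→ S← (a : Fin k) π → Irreflexive (newArcs S→ S← a π)
newArcs-irreflexive S→ S← a π zero    = refl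
newArcs-irreflexive S→ S← a π (suc b) = refl

extend : ∀ {k n} (e : LCW (suc k) n) → Fin k → LabelRel (suc k) → LCW (suc k) (suc n)
extend e c E = ρ zero (suc c) (αAll E (add e zero))

simulate-ext : ∀ {k n} {e : LCW (suc k) n} {t π} → Simulates e t π →
  ∀ S→ S← {a c} → π c ≡ a →
  Simulates (extend e c (newArcs S→ S← a π)) (ext t S→ S← a) π
simulate-ext {k} {n} {e} {t} {π} sim S→ S← {a} {c} πc≡a = record { label = label′ ; arcs = arcs′ }
  where
  E : LabelRel (suc k)
  E = newArcs S→ S← a π
  connected : AddsArcs E (αAll E)
  connected = αAll-adds (newArcs-irreflexive S→ S← a π)
  e₀ : LCW (suc k) (suc n)
  e₀ = add e zero

  label′ : ∀ u → Σ (Fin k) λ c′ → labC (extend e c E) u ≡ suc c′ × π c′ ≡ labL (ext t S→ S← a) u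
  label′ zero = c , cong (rename zero (suc c)) (keeps-lab connected e₀ zero) , πc≡a
  label′ (suc u) with label sim u
  ... | c′ , lab≡ , πc′ = c′ , cong (rename zero (suc c)) (trans (keeps-lab connected e₀ (suc u)) lab≡) , πc′

  arcs′ : ∀ u v → arcC (extend e c E) u v ≡ arcL (ext t S→ S← a) u v
  arcs′ zero zero = adds-arc connected e₀ zero zero
  arcs′ zero (suc v) with label sim v
  ... | cv , lab≡ , πcv =
    trans (adds-arc connected e₀ zero (suc v)) (trans (cong (E zero) lab≡) (cong (λ z → S← z a) πcv))
  arcs′ (suc u) zero with label sim u
  ... | cu , lab≡ , πcu =
    trans (adds-arc connected e₀ (suc u) zero) (trans (cong (flip E zero) lab≡) (cong (λ z → S→ z a) πcu))
  arcs′ (suc u) (suc v) with label sim u | label sim v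
  ... | cu , labu≡ , _ | cv , labv≡ , _ =
    begin
      arcC (extend e c E) (suc u) (suc v)
    ≡⟨ adds-arc connected e₀ (suc u) (suc v) ⟩
      arcC e u v ∨ E (labC e u) (labC e v)
    ≡⟨ cong (arcC e u v ∨_) (cong₂ E labu≡ labv≡) ⟩
      arcC e u v ∨ false
    ≡⟨ ∨-identityʳ _ ⟩
      arcC e u v
    ≡⟨ arcs sim u v ⟩
      arcL t u v
    ∎

simulate : ∀ {k n} (t : LNL k n) → Σ (LCW (suc k) n) λ e → Σ (Fin k → Fin k) λ π → Simulates e t π
simulate (vtx a) = vtx (suc a) , (λ c → c) , record
  { label = λ _ → a , refl , refl ; arcs = λ _ _ → refl }
simulate (relab R t) with simulate t
... | e , π , sim = e , R ∘ π , record
  { label = λ u → let c , lab≡ , πc = label sim u in c , lab≡ , cong R πc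
  ; arcs  = arcs sim }
simulate (ext t S→ S← a) with simulate t
... | e , π , sim with freshen sim a
...   | e′ , π′ , c , π′c≡a , sim′ =
  extend e′ c (newArcs S→ S← a π′) , π′ , simulate-ext sim′ S→ S← π′c≡a

lnl⇒lcw : ∀ {k} G → LnlBuildable k G → LcwBuildable (suc k) G
lnl⇒lcw G (t , f , represents) with simulate t
... | e , _ , sim = e , f , λ u v → trans (arcs sim u v) (represents u v)

lemma5p1 : (G : Digraph) (k l : ℕ) → IsDLnlcw G k → IsDLcw G l →
    (k ≤ l) × (l ≤ k + 1)
lemma5p1 G k l (lnl-k , lnl-minimal) (lcw-l , lcw-minimal) =
  lnl-minimal l (lcw⇒lnl G lcw-l) ,
  lcw-minimal (k + 1) (subst (λ m → LcwBuildable m G) (+-comm 1 k) (lnl⇒lcw G lnl-k))
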